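{- Let $\pi\in S_n$. Then $\mathrm{bub}(\mathrm{psb}(\pi))=12\cdots n$ if and only if $\pi\in\mathrm{Av}(2341,3421,3241,25314,52314,53214)$.
   Context: $\mathrm{Av}(T)$ is the set of permutations avoiding every pattern in $T$. The algorithm PSB processes $\pi=\pi_1\cdots\pi_n$ from left to right with one pop stack $S$ (initially empty; PUSH puts an element on top, POP removes all elements appending them to the output from top to bottom) and an initially empty output: for $i=1,\dots,n$, if $S$ is empty or $\pi_i=\mathrm{TOP}(S)-1$ (where $\mathrm{TOP}(S)$ is the top element of $S$), push $\pi_i$; else if $\pi_i<\mathrm{TOP}(S)-1$, append $\pi_i$ directly to the output (bypass); otherwise pop $S$ and then push $\pi_i$. After all entries are processed, pop $S$; the output is $\mathrm{psb}(\pi)$. $\mathrm{bub}(\tau)$ is the result of a single pass of Bubblesort on $\tau=\tau_1\cdots\tau_n$: for $i=1,\dots,n-1$ in order, if the entry currently in position $i$ is larger than the entry currently in position $i+1$, swap them. -}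

module Defs where

open import Data.Nat using (ℕ; zero; suc; _<_; _≡ᵇ_; _<ᵇ_)
open import Data.Nat.Properties using (_≟_)
open import Data.Bool using (Bool; true; false; if_then_else_)
open import Data.List using (List; []; _∷_; _++_; reverse; map; upTo; length)
open import Data.List.Relation.Binary.Sublist.Propositional using (_⊆_)
open import Data.List.Relation.Binary.Pointwise using (Pointwise)
open import Data.List.Relation.Binary.Permutation.Propositional using (_↭_)
open import Data.Product using (_×_; ∃-syntax)
open import Data.List.Membership.Propositional using (_∈_)
open import Function.Bundles using (_⇔_)
open import Relation.Nullary using (¬_)
open import Relation.Binary.PropositionalEquality using (_≡_)

IsPerm : ℕ → List ℕ → Set
IsPerm n π = π ↭ map suc (upTo n)

idPerm : ℕ → List ℕ
idPerm n = map suc (upTo n)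

data OrdIso : List ℕ → List ℕ → Set where
  [] : OrdIso [] []
  _∷_ : ∀ {x y xs ys} →
        Pointwise (λ x' y' → ((x < x') ⇔ (y < y')) × ((x' < x) ⇔ (y' < y))) xs ys →
        OrdIso xs ys → OrdIso (x ∷ xs) (y ∷ ys)

Contains : List ℕ → List ℕ → Set
Contains π p = ∃[ σ ] (σ ⊆ π × OrdIso σ p)

Avoids : List ℕ → List (List ℕ) → Set
Avoids π T = ∀ p → p ∈ T → ¬ Contains π p

-- Pop-stack with bypass (PSB).  The stack is a list whose head is the top;
-- the output is accumulated in order.  POP appends the stack contents from
-- top to bottom, i.e. the stack list as is.
psb-go : List ℕ → List ℕ → List ℕ → List ℕ
psb-go stack out [] = out ++ stack
psb-go [] out (x ∷ xs) = psb-go (x ∷ []) out xs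
psb-go (t ∷ st) out (x ∷ xs) =
  if suc x ≡ᵇ t then psb-go (x ∷ t ∷ st) out xs
  else if suc x <ᵇ t then psb-go (t ∷ st) (out ++ (x ∷ [])) xs
  else psb-go (x ∷ []) (out ++ (t ∷ st)) xs

psb : List ℕ → List ℕ
psb π = psb-go [] [] π

-- One pass of Bubblesort: carry the current running entry to the right.
bub-go : ℕ → List ℕ → List ℕ
bub-go c [] = c ∷ []
bub-go c (y ∷ ys) = if y <ᵇ c then y ∷ bub-go c ys else c ∷ bub-go y ys

bub : List ℕ → List ℕ
bub [] = []
bub (x ∷ xs) = bub-go x xs

patterns18 : List (List ℕ)
patterns18 =
  (2 ∷ 3 ∷ 4 ∷ 1 ∷ []) ∷ (3 ∷ 4 ∷ 2 ∷ 1 ∷ []) ∷ (3 ∷ 2 ∷ 4 ∷ 1 ∷ []) ∷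
  (2 ∷ 5 ∷ 3 ∷ 1 ∷ 4 ∷ []) ∷ (5 ∷ 2 ∷ 3 ∷ 1 ∷ 4 ∷ []) ∷ (5 ∷ 3 ∷ 2 ∷ 1 ∷ 4 ∷ []) ∷ []

module Submission where

-- While PSB runs, its stack is always a block s, s+1, …, s+k of consecutive values, the largest values
-- read so far, pushed in decreasing order; everything below s has already been output.  Run the pass of
-- Bubblesort alongside, tracking the entry b it emitted last and the entry c it carries.  Since bub(psb π)
-- is a permutation, it is the identity iff the pass only emits increasing entries, and by this invariant
-- the only step that can emit a descent is an entry x that bypasses the stack while x < c and x < b.
-- At that step b < c < s, and s − 1 either precedes s or follows x, so x together with b, c, s − 1 and s
-- contains one of the six patterns.  Conversely every occurrence of a pattern yields such an obstruction
-- around its entry 1, and the invariant shows that the pass fails when this entry is read.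

open import Defs
open import Data.Bool using (true; false; T)
open import Data.Bool.Properties using (T-≡)
open import Data.Empty using (⊥)
open import Data.List using (List; []; _∷_; _++_; [_]; map)
open import Data.List.Properties using (++-assoc; ++-identityʳ)
open import Data.List.Membership.Propositional using (_∈_; _∉_)
open import Data.List.Membership.Propositional.Properties
  using (∈-++⁺ˡ; ∈-++⁺ʳ; ∈-++⁻; ∈-map⁺; ∈-map⁻; ∈-upTo⁺; ∈-upTo⁻)
open import Data.List.Relation.Binary.Permutation.Propositional
  using (_↭_; refl; prep; swap; ↭-trans; ↭-sym; ↭-reflexive; ↭⇒↭ₛ)
open import Data.List.Relation.Binary.Permutation.Propositional.Properties using (++⁺ˡ; shift; ∈-resp-↭)
import Data.List.Relation.Binary.Permutation.Setoid.Properties as PermutationProperties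
open import Data.List.Relation.Binary.Pointwise using (Pointwise; []; _∷_; Pointwise-≡⇒≡)
open import Data.List.Relation.Binary.Sublist.Propositional
  using (_⊆_; []; _∷_; _∷ʳ_; from∈; ⊆-refl; ⊆-trans; minimum)
open import Data.List.Relation.Binary.Sublist.Propositional.Properties using (++⁺; ++⁺ʳ; Any-resp-⊆)
import Data.List.Relation.Unary.All.Properties as All
open import Data.List.Relation.Unary.AllPairs using ([]; _∷_)
open import Data.List.Relation.Unary.Any using (here; there)
open import Data.List.Relation.Unary.Linked as Linked using (Linked; []; [-]; _∷_)
import Data.List.Relation.Unary.Linked.Properties as Linked
import Data.List.Relation.Unary.Sorted.TotalOrder.Properties as Sorted
open import Data.List.Relation.Unary.Unique.Propositional using (Unique)
import Data.List.Relation.Unary.Unique.Propositional.Properties as Unique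
open import Data.Nat using (ℕ; zero; suc; _+_; _≤_; _<_; _≡ᵇ_; _<ᵇ_; z≤n; s≤s; s≤s⁻¹; z<s; s<s; _<?_)
open import Data.Nat.Properties
open import Data.Product using (_×_; _,_; proj₁; proj₂; map₁; ∃-syntax)
open import Data.Sum using (_⊎_; inj₁; inj₂; map₂)
open import Function using (_∘_)
open import Function.Bundles using (_⇔_; mk⇔; Equivalence)
open import Function.Properties.Equivalence using (⇔-setoid) renaming (refl to ⇔-refl; trans to ⇔-trans)
open import Level using (0ℓ)
open import Relation.Binary.Core using (_Preserves_⟶_)
open import Relation.Binary.Definitions using (tri<; tri≈; tri>)
open import Relation.Binary.PropositionalEquality
  using (_≡_; _≢_; refl; sym; trans; cong; subst; subst₂; setoid; module ≡-Reasoning)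
import Relation.Binary.Reasoning.Setoid as SetoidReasoning
open import Relation.Nullary using (¬_; contradiction; yes; no)
open import Relation.Nullary.Reflects using (ofʸ)

<ᵇ-true : ∀ {m n} → m < n → (m <ᵇ n) ≡ true
<ᵇ-true m<n = Equivalence.to T-≡ (<⇒<ᵇ m<n)

<ᵇ-false : ∀ {m n} → n ≤ m → (m <ᵇ n) ≡ false
<ᵇ-false {m} {n} n≤m with m <ᵇ n | <ᵇ-reflects-< m n
... | false | _        = refl
... | true  | ofʸ m<n = contradiction m<n (≤⇒≯ n≤m)

≡ᵇ-refl : ∀ n → (n ≡ᵇ n) ≡ true
≡ᵇ-refl n = Equivalence.to T-≡ (≡⇒≡ᵇ n n refl)

≡ᵇ-false : ∀ {m n} → m ≢ n → (m ≡ᵇ n) ≡ false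
≡ᵇ-false {m} {n} m≢n with m ≡ᵇ n in eq
... | false = refl
... | true  = contradiction (≡ᵇ⇒≡ m n (subst T (sym eq) _)) m≢n

-- BubbleRun b c ys: given b < c, continuing the pass on ys after emitting b and while carrying c
-- emits an increasing sequence.
data BubbleRun : ℕ → ℕ → List ℕ → Set where
  []    : ∀ {b c} → BubbleRun b c []
  emit  : ∀ {b c y ys} → b < y → y < c → BubbleRun y c ys → BubbleRun b c (y ∷ ys)
  carry : ∀ {b c y ys} → c < y → BubbleRun c y ys → BubbleRun b c (y ∷ ys)

emit⇔ : ∀ {b c y ys} → y < c → BubbleRun b c (y ∷ ys) ⇔ (b < y × BubbleRun y c ys)
emit⇔ {c = c} {y} y<c = mk⇔ to (λ (b<y , run) → emit b<y y<c run)
  where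
  to : ∀ {b ys} → BubbleRun b c (y ∷ ys) → b < y × BubbleRun y c ys
  to (emit b<y _ run) = b<y , run
  to (carry c<y _)    = contradiction y<c (<⇒≯ c<y)

carry⇔ : ∀ {b c y ys} → c < y → BubbleRun b c (y ∷ ys) ⇔ BubbleRun c y ys
carry⇔ {c = c} {y} c<y = mk⇔ to (carry c<y)
  where
  to : ∀ {b ys} → BubbleRun b c (y ∷ ys) → BubbleRun c y ys
  to (emit _ y<c _) = contradiction y<c (<⇒≯ c<y)
  to (carry _ run)  = run

bub-go-emit : ∀ {c y} ys → y < c → bub-go c (y ∷ ys) ≡ y ∷ bub-go c ys
bub-go-emit ys y<c rewrite <ᵇ-true y<c = refl

bub-go-carry : ∀ {c y} ys → c ≤ y → bub-go c (y ∷ ys) ≡ c ∷ bub-go y ys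
bub-go-carry ys c≤y rewrite <ᵇ-false c≤y = refl

bub-go-ascending : ∀ {b c} ys → Linked _<_ (b ∷ bub-go c ys) ⇔ (b < c × BubbleRun b c ys)
bub-go-ascending ys = mk⇔ (to ys) from
  where
  to : ∀ {b c} ys → Linked _<_ (b ∷ bub-go c ys) → b < c × BubbleRun b c ys
  to []       (b<c ∷ [-]) = b<c , []
  to {b} {c} (y ∷ ys) asc with y <? c
  ... | yes y<c rewrite bub-go-emit ys y<c =
    let b<y = Linked.head asc in <-trans b<y y<c , emit b<y y<c (proj₂ (to ys (Linked.tail asc)))
  ... | no  y≮c rewrite bub-go-carry ys (≮⇒≥ y≮c) =
    let (c<y , run) = to ys (Linked.tail asc) in Linked.head asc , carry c<y run
  from : ∀ {b c ys} → b < c × BubbleRun b c ys → Linked _<_ (b ∷ bub-go c ys)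
  from (b<c , []) = b<c ∷ [-]
  from (b<c , emit {ys = ys} b<y y<c run) rewrite bub-go-emit ys y<c = b<y ∷ from (y<c , run)
  from (b<c , carry {ys = ys} c<y run) rewrite bub-go-carry ys (<⇒≤ c<y) = b<c ∷ from (c<y , run)

bub-ascending : ∀ σ → Linked _<_ (0 ∷ bub σ) ⇔ BubbleRun 0 0 σ
bub-ascending []       = mk⇔ (λ _ → []) (λ _ → [-])
bub-ascending (x ∷ xs) = mk⇔ to from
  where
  to : Linked _<_ (0 ∷ bub-go x xs) → BubbleRun 0 0 (x ∷ xs)
  to asc = let (0<x , run) = Equivalence.to (bub-go-ascending xs) asc in carry 0<x run
  from : BubbleRun 0 0 (x ∷ xs) → Linked _<_ (0 ∷ bub-go x xs)
  from (carry 0<x run) = Equivalence.from (bub-go-ascending xs) (0<x , run)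

bub-go-↭ : ∀ c ys → bub-go c ys ↭ c ∷ ys
bub-go-↭ c []       = refl
bub-go-↭ c (y ∷ ys) with y <ᵇ c
... | true  = ↭-trans (prep y (bub-go-↭ c ys)) (swap y c refl)
... | false = prep c (bub-go-↭ y ys)

bub-↭ : ∀ σ → bub σ ↭ σ
bub-↭ []       = refl
bub-↭ (x ∷ xs) = bub-go-↭ x xs

idPerm-ascending : ∀ n → Linked _<_ (0 ∷ idPerm n)
idPerm-ascending zero    = [-]
idPerm-ascending (suc n) =
  z<s ∷ Linked.map⁺ (Linked.map s<s (Linked.applyUpTo⁺₁ (λ i → i) (suc n) (λ _ → n<1+n _)))

ascending-↭⇒≡ : ∀ {xs ys} → Linked _<_ (0 ∷ xs) → Linked _<_ (0 ∷ ys) → xs ↭ ys → xs ≡ ys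
ascending-↭⇒≡ xs↗ ys↗ xs↭ys =
  Pointwise-≡⇒≡ (Sorted.↗↭↗⇒≋ ≤-totalOrder (weaken xs↗) (weaken ys↗) (↭⇒↭ₛ xs↭ys))
  where
  weaken : ∀ {xs} → Linked _<_ (0 ∷ xs) → Linked _≤_ xs
  weaken = Linked.map <⇒≤ ∘ Linked.tail

bub-sorts⇔ : ∀ {n σ} → IsPerm n σ → (bub σ ≡ idPerm n) ⇔ BubbleRun 0 0 σ
bub-sorts⇔ {n} {σ} σ↭id = mk⇔ to from
  where
  to : bub σ ≡ idPerm n → BubbleRun 0 0 σ
  to sorted = Equivalence.to (bub-ascending σ) (subst (Linked _<_ ∘ (0 ∷_)) (sym sorted) (idPerm-ascending n))
  from : BubbleRun 0 0 σ → bub σ ≡ idPerm n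
  from run = ascending-↭⇒≡ (Equivalence.from (bub-ascending σ) run) (idPerm-ascending n) (↭-trans (bub-↭ σ) σ↭id)

psb-go-output : ∀ st out xs → psb-go st out xs ≡ out ++ psb-go st [] xs
psb-go-output st       out []       = refl
psb-go-output []       out (x ∷ xs) = psb-go-output [ x ] out xs
psb-go-output (t ∷ st) out (x ∷ xs) with suc x ≡ᵇ t | suc x <ᵇ t
... | true  | _     = psb-go-output (x ∷ t ∷ st) out xs
... | false | true  = begin
  psb-go (t ∷ st) (out ++ [ x ]) xs        ≡⟨ psb-go-output (t ∷ st) (out ++ [ x ]) xs ⟩
  (out ++ [ x ]) ++ psb-go (t ∷ st) [] xs  ≡⟨ ++-assoc out [ x ] _ ⟩
  out ++ x ∷ psb-go (t ∷ st) [] xs         ≡⟨ cong (out ++_) (psb-go-output (t ∷ st) [ x ] xs) ⟨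
  out ++ psb-go (t ∷ st) [ x ] xs          ∎
  where open ≡-Reasoning
... | false | false = begin
  psb-go [ x ] (out ++ t ∷ st) xs        ≡⟨ psb-go-output [ x ] (out ++ t ∷ st) xs ⟩
  (out ++ t ∷ st) ++ psb-go [ x ] [] xs  ≡⟨ ++-assoc out (t ∷ st) _ ⟩
  out ++ (t ∷ st) ++ psb-go [ x ] [] xs  ≡⟨ cong (out ++_) (psb-go-output [ x ] (t ∷ st) xs) ⟨
  out ++ psb-go [ x ] (t ∷ st) xs        ∎
  where open ≡-Reasoning

psb-go-↭ : ∀ st out xs → psb-go st out xs ↭ out ++ st ++ xs
psb-go-↭ st       out []       = ↭-reflexive (cong (out ++_) (sym (++-identityʳ st)))
psb-go-↭ []       out (x ∷ xs) = psb-go-↭ [ x ] out xs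
psb-go-↭ (t ∷ st) out (x ∷ xs) with suc x ≡ᵇ t | suc x <ᵇ t
... | true  | _     = ↭-trans (psb-go-↭ (x ∷ t ∷ st) out xs) (++⁺ˡ out (↭-sym (shift x (t ∷ st) xs)))
... | false | true  = ↭-trans (psb-go-↭ (t ∷ st) (out ++ [ x ]) xs)
                        (↭-trans (↭-reflexive (++-assoc out [ x ] _)) (++⁺ˡ out (↭-sym (shift x (t ∷ st) xs))))
... | false | false = ↭-trans (psb-go-↭ [ x ] (out ++ t ∷ st) xs) (↭-reflexive (++-assoc out (t ∷ st) _))

psb-↭ : ∀ π → psb π ↭ π
psb-↭ = psb-go-↭ [] []

psb-push : ∀ x st R → psb-go (suc x ∷ st) [] (x ∷ R) ≡ psb-go (x ∷ suc x ∷ st) [] R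
psb-push x st R rewrite ≡ᵇ-refl x = refl

psb-bypass : ∀ {x t} st R → suc x < t → psb-go (t ∷ st) [] (x ∷ R) ≡ x ∷ psb-go (t ∷ st) [] R
psb-bypass st R sx<t rewrite ≡ᵇ-false (<⇒≢ sx<t) | <ᵇ-true sx<t = psb-go-output _ [ _ ] R

psb-pop : ∀ {x t} st R → t ≤ x → psb-go (t ∷ st) [] (x ∷ R) ≡ (t ∷ st) ++ psb-go [ x ] [] R
psb-pop st R t≤x rewrite ≡ᵇ-false (<⇒≢ (s≤s t≤x) ∘ sym) | <ᵇ-false (m≤n⇒m≤1+n t≤x) =
  psb-go-output [ _ ] (_ ∷ st) R

-- PSB only ever pushes the predecessor of the top, so its stack is always s, s+1, …, s+k (top first).
blockFrom : ℕ → ℕ → List ℕ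
blockFrom t zero    = []
blockFrom t (suc k) = t ∷ blockFrom (suc t) k

block : ℕ → ℕ → List ℕ
block s k = s ∷ blockFrom (suc s) k

-- The last entry the bubble pass emits after reading a popped block, having carried c into it.
blockEmitted : ℕ → ℕ → ℕ → ℕ
blockEmitted c s zero    = c
blockEmitted c s (suc k) = s + k

blockEmitted-shift : ∀ s k → blockEmitted s (suc s) k ≡ s + k
blockEmitted-shift s zero    = sym (+-identityʳ s)
blockEmitted-shift s (suc k) = sym (+-suc s k)

BubbleRun-block : ∀ {b c s} k L → c < s →
                  BubbleRun b c (block s k ++ L) ⇔ BubbleRun (blockEmitted c s k) (s + k) L
BubbleRun-block {s = s} zero L c<s rewrite +-identityʳ s = carry⇔ c<s
BubbleRun-block {c = c} {s} (suc k) L c<s = ⇔-trans (carry⇔ c<s)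
  (subst₂ (λ b′ c′ → BubbleRun c s (block (suc s) k ++ L) ⇔ BubbleRun b′ c′ L)
          (blockEmitted-shift s k) (sym (+-suc s k)) (BubbleRun-block k L (n<1+n s)))

c≤blockEmitted : ∀ {c s} k → c ≤ s → c ≤ blockEmitted c s k
c≤blockEmitted zero    c≤s = ≤-refl
c≤blockEmitted {s = s} (suc k) c≤s = ≤-trans c≤s (m≤m+n s k)

inner≤blockEmitted : ∀ {c s y} k → s ≤ y → y < s + k → y ≤ blockEmitted c s k
inner≤blockEmitted {s = s} zero    s≤y y<s+0 = contradiction (subst (_ <_) (+-identityʳ s) y<s+0) (≤⇒≯ s≤y)
inner≤blockEmitted {s = s} {y} (suc k) s≤y y<s+k+1 = s≤s⁻¹ (subst (y <_) (+-suc s k) y<s+k+1)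

∈-snoc⁻ : ∀ {y x : ℕ} P → y ∈ P ++ [ x ] → y ∈ P ⊎ y ≡ x
∈-snoc⁻ P y∈ with ∈-++⁻ P y∈
... | inj₁ y∈P       = inj₁ y∈P
... | inj₂ (here y≡x) = inj₂ y≡x

∈-snoc : ∀ (P : List ℕ) x → x ∈ P ++ [ x ]
∈-snoc P x = ∈-++⁺ʳ P (here refl)

⊆-snoc : ∀ {v : ℕ} {P} x → v ∈ P → (v ∷ x ∷ []) ⊆ P ++ [ x ]
⊆-snoc x v∈P = ++⁺ (from∈ v∈P) ⊆-refl

⊆-split : ∀ (xs : List ℕ) z ys {π} → (xs ++ z ∷ ys) ⊆ π → ∃[ P ] ∃[ R ] (P ++ z ∷ R ≡ π × xs ⊆ P × ys ⊆ R)
⊆-split []       z ys (p ∷ʳ sub) with P , R , eq , xs⊆P , ys⊆R ← ⊆-split [] z ys sub =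
  p ∷ P , R , cong (p ∷_) eq , p ∷ʳ xs⊆P , ys⊆R
⊆-split []       z ys (refl ∷ sub) = [] , _ , refl , [] , sub
⊆-split (x ∷ xs) z ys (p ∷ʳ sub) with P , R , eq , xs⊆P , ys⊆R ← ⊆-split (x ∷ xs) z ys sub =
  p ∷ P , R , cong (p ∷_) eq , p ∷ʳ xs⊆P , ys⊆R
⊆-split (x ∷ xs) z ys (refl ∷ sub) with P , R , eq , xs⊆P , ys⊆R ← ⊆-split xs z ys sub =
  x ∷ P , R , cong (x ∷_) eq , refl ∷ xs⊆P , ys⊆R

∈⇒ordered : ∀ {x y : ℕ} {P} → x ∈ P → y ∈ P → x ≢ y → (x ∷ y ∷ []) ⊆ P ⊎ (y ∷ x ∷ []) ⊆ P
∈⇒ordered (here refl) (here refl) x≢y = contradiction refl x≢y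
∈⇒ordered (here refl) (there y∈) _ = inj₁ (refl ∷ from∈ y∈)
∈⇒ordered (there x∈) (here refl) _ = inj₂ (refl ∷ from∈ x∈)
∈⇒ordered {P = p ∷ _} (there x∈) (there y∈) x≢y with ∈⇒ordered x∈ y∈ x≢y
... | inj₁ xy = inj₁ (p ∷ʳ xy)
... | inj₂ yx = inj₂ (p ∷ʳ yx)

insert-ordered : ∀ {a u v : ℕ} {P} → a ∈ P → (u ∷ v ∷ []) ⊆ P → a ≢ u → a ≢ v →
                 (a ∷ u ∷ v ∷ []) ⊆ P ⊎ (u ∷ a ∷ v ∷ []) ⊆ P ⊎ (u ∷ v ∷ a ∷ []) ⊆ P
insert-ordered (here refl) (_ ∷ʳ uv) _ _ = inj₁ (refl ∷ uv)
insert-ordered (here refl) (refl ∷ _) a≢u _ = contradiction refl a≢u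
insert-ordered {P = p ∷ _} (there a∈) (_ ∷ʳ uv) a≢u a≢v with insert-ordered a∈ uv a≢u a≢v
... | inj₁ auv        = inj₁ (p ∷ʳ auv)
... | inj₂ (inj₁ uav) = inj₂ (inj₁ (p ∷ʳ uav))
... | inj₂ (inj₂ uva) = inj₂ (inj₂ (p ∷ʳ uva))
insert-ordered (there a∈) (refl ∷ v) _ a≢v with ∈⇒ordered a∈ (Any-resp-⊆ v (here refl)) a≢v
... | inj₁ av = inj₂ (inj₁ (refl ∷ av))
... | inj₂ va = inj₂ (inj₂ (refl ∷ va))

Unique-++⁻ˡ : ∀ (xs : List ℕ) {ys} → Unique (xs ++ ys) → Unique xs
Unique-++⁻ˡ []       _             = []
Unique-++⁻ˡ (x ∷ xs) (x∉ ∷ unique) = All.++⁻ˡ xs x∉ ∷ Unique-++⁻ˡ xs unique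

Unique-++⇒disjoint : ∀ (xs : List ℕ) {ys x} → Unique (xs ++ ys) → x ∈ xs → x ∉ ys
Unique-++⇒disjoint (_ ∷ xs) (x∉ ∷ _)      (here refl) = All.All¬⇒¬Any (All.++⁻ʳ xs x∉)
Unique-++⇒disjoint (_ ∷ xs) (_ ∷ unique) (there x∈)  = Unique-++⇒disjoint xs unique x∈

Unique⇒¬both-orders : ∀ {u v : ℕ} {xs} → Unique xs → u ≢ v → (u ∷ v ∷ []) ⊆ xs → ¬ (v ∷ u ∷ []) ⊆ xs
Unique⇒¬both-orders (_ ∷ unique) u≢v (_ ∷ʳ uv) (_ ∷ʳ vu) = Unique⇒¬both-orders unique u≢v uv vu
Unique⇒¬both-orders (u∉ ∷ _) _ (refl ∷ v) (_ ∷ʳ vu) = All.All¬⇒¬Any u∉ (Any-resp-⊆ vu (there (here refl)))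
Unique⇒¬both-orders (v∉ ∷ _) _ (_ ∷ʳ uv) (refl ∷ u) = All.All¬⇒¬Any v∉ (Any-resp-⊆ uv (there (here refl)))
Unique⇒¬both-orders _ u≢v (refl ∷ _) (v≡u ∷ _) = u≢v (sym v≡u)

∈-idPerm : ∀ {n x} → x ∈ idPerm n ⇔ (0 < x × x ≤ n)
∈-idPerm {n} = mk⇔ to from
  where
  to : ∀ {x} → x ∈ idPerm n → 0 < x × x ≤ n
  to x∈ with i , i∈ , refl ← ∈-map⁻ suc x∈ = z<s , ∈-upTo⁻ i∈
  from : ∀ {x} → 0 < x × x ≤ n → x ∈ idPerm n
  from {suc x} (_ , x<n) = ∈-map⁺ suc (∈-upTo⁺ x<n)

IsPerm⇒Unique : ∀ {n π} → IsPerm n π → Unique π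
IsPerm⇒Unique {n} π↭id = PermutationProperties.Unique-resp-↭ (setoid ℕ) (↭⇒↭ₛ (↭-sym π↭id))
                           (Unique.map⁺ suc-injective (Unique.upTo⁺ n))

IsPerm⇒positive : ∀ {n π x} → IsPerm n π → x ∈ π → 0 < x
IsPerm⇒positive π↭id x∈π = proj₁ (Equivalence.to ∈-idPerm (∈-resp-↭ π↭id x∈π))

IsPerm⇒pred∈ : ∀ {n π w} → IsPerm n π → suc w ∈ π → 0 < w → w ∈ π
IsPerm⇒pred∈ π↭id 1+w∈π 0<w = ∈-resp-↭ (↭-sym π↭id)
  (Equivalence.from ∈-idPerm (0<w , <⇒≤ (proj₂ (Equivalence.to ∈-idPerm (∈-resp-↭ π↭id 1+w∈π)))))

-- P is the input read so far and block s k the stack.  Had s − 1 come after s, it would have been pushed.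
record StackInvariant (P : List ℕ) (s k : ℕ) : Set where
  field
    bounded         : ∀ {y} → y ∈ P → y ≤ s + k
    block⊆          : ∀ {y} → s ≤ y → y ≤ s + k → y ∈ P
    block-reversed  : ∀ {u v} → s ≤ u → u < v → v ≤ s + k → (v ∷ u ∷ []) ⊆ P
    pred-before-top : ∀ {y} → suc y ≡ s → y ∈ P → (y ∷ s ∷ []) ⊆ P

-- The entries of P below s are those output so far; b and c are the state of the pass on this output.
record OutputInvariant (P : List ℕ) (s b c : ℕ) : Set where
  field
    output-bound : ∀ {y} → y ∈ P → y < s → y ≤ c × (y ≡ c ⊎ y ≤ b)
    emitted-seen : b ≡ 0 ⊎ (b ∈ P × b < c)
    carried-seen : c ≡ 0 ⊎ c ∈ P
    carried<top  : c < s

open StackInvariant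
open OutputInvariant

stack-new-max : ∀ {P x} → (∀ {y} → y ∈ P → y < x) → StackInvariant (P ++ [ x ]) x 0
stack-new-max {P} {x} below = record
  { bounded         = bounded′
  ; block⊆          = λ x≤y y≤x+0 → subst (_∈ P ++ [ x ]) (≤-antisym x≤y (≤-top y≤x+0)) (∈-snoc P x)
  ; block-reversed  = λ x≤u u<v v≤x+0 → contradiction (≤-<-trans x≤u u<v) (≤⇒≯ (≤-top v≤x+0))
  ; pred-before-top = pred-before-top′
  }
  where
  ≤-top : ∀ {y} → y ≤ x + 0 → y ≤ x
  ≤-top y≤x+0 = ≤-trans y≤x+0 (≤-reflexive (+-identityʳ x))
  bounded′ : ∀ {y} → y ∈ P ++ [ x ] → y ≤ x + 0
  bounded′ y∈ with ∈-snoc⁻ P y∈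
  ... | inj₁ y∈P  = ≤-trans (<⇒≤ (below y∈P)) (m≤m+n x 0)
  ... | inj₂ refl = m≤m+n x 0
  pred-before-top′ : ∀ {y} → suc y ≡ x → y ∈ P ++ [ x ] → (y ∷ x ∷ []) ⊆ P ++ [ x ]
  pred-before-top′ 1+y≡x y∈ with ∈-snoc⁻ P y∈
  ... | inj₁ y∈P  = ⊆-snoc x y∈P
  ... | inj₂ refl = contradiction 1+y≡x 1+n≢n

output-start : ∀ {x} → 0 < x → OutputInvariant [ x ] x 0 0
output-start 0<x = record
  { output-bound = λ { (here refl) x<x → contradiction x<x (<-irrefl refl) }
  ; emitted-seen = inj₁ refl
  ; carried-seen = inj₁ refl
  ; carried<top  = 0<x
  }

stack-push : ∀ {P x k} → StackInvariant P (suc x) k → StackInvariant (P ++ [ x ]) x (suc k)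
stack-push {P} {x} {k} I = record
  { bounded         = bounded′
  ; block⊆          = block⊆′
  ; block-reversed  = block-reversed′
  ; pred-before-top = pred-before-top′
  }
  where
  top≡ : suc x + k ≡ x + suc k
  top≡ = sym (+-suc x k)
  bounded′ : ∀ {y} → y ∈ P ++ [ x ] → y ≤ x + suc k
  bounded′ y∈ with ∈-snoc⁻ P y∈
  ... | inj₁ y∈P = ≤-trans (bounded I y∈P) (≤-reflexive top≡)
  ... | inj₂ refl = m≤m+n x (suc k)
  block⊆′ : ∀ {y} → x ≤ y → y ≤ x + suc k → y ∈ P ++ [ x ]
  block⊆′ x≤y y≤ with m≤n⇒m<n∨m≡n x≤y
  ... | inj₁ x<y  = ∈-++⁺ˡ (block⊆ I x<y (≤-trans y≤ (≤-reflexive (sym top≡))))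
  ... | inj₂ refl = ∈-snoc P x
  block-reversed′ : ∀ {u v} → x ≤ u → u < v → v ≤ x + suc k → (v ∷ u ∷ []) ⊆ P ++ [ x ]
  block-reversed′ x≤u u<v v≤ with m≤n⇒m<n∨m≡n x≤u
  ... | inj₁ x<u  = ++⁺ʳ [ x ] (block-reversed I x<u u<v (≤-trans v≤ (≤-reflexive (sym top≡))))
  ... | inj₂ refl = ⊆-snoc x (block⊆ I u<v (≤-trans v≤ (≤-reflexive (sym top≡))))
  pred-before-top′ : ∀ {y} → suc y ≡ x → y ∈ P ++ [ x ] → (y ∷ x ∷ []) ⊆ P ++ [ x ]
  pred-before-top′ 1+y≡x y∈ with ∈-snoc⁻ P y∈
  ... | inj₁ y∈P  = ⊆-snoc x y∈P
  ... | inj₂ refl = contradiction 1+y≡x 1+n≢n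

output-push : ∀ {P x b c} → OutputInvariant P (suc x) b c → x ∉ P → 0 < x →
              OutputInvariant (P ++ [ x ]) x b c
output-push {P} {x} {b} {c} I x∉P 0<x = record
  { output-bound = output-bound′
  ; emitted-seen = map₂ (map₁ ∈-++⁺ˡ) (emitted-seen I)
  ; carried-seen = map₂ ∈-++⁺ˡ (carried-seen I)
  ; carried<top  = carried<x (carried-seen I)
  }
  where
  output-bound′ : ∀ {y} → y ∈ P ++ [ x ] → y < x → y ≤ c × (y ≡ c ⊎ y ≤ b)
  output-bound′ y∈ y<x with ∈-snoc⁻ P y∈
  ... | inj₁ y∈P  = output-bound I y∈P (m<n⇒m<1+n y<x)
  ... | inj₂ refl = contradiction y<x (<-irrefl refl)
  carried<x : c ≡ 0 ⊎ c ∈ P → c < x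
  carried<x (inj₁ refl) = 0<x
  carried<x (inj₂ c∈P)  = ≤∧≢⇒< (s≤s⁻¹ (carried<top I)) (λ { refl → x∉P c∈P })

stack-bypass : ∀ {P x s k} → StackInvariant P s k → suc x < s → StackInvariant (P ++ [ x ]) s k
stack-bypass {P} {x} {s} {k} I 1+x<s = record
  { bounded         = bounded′
  ; block⊆          = λ s≤y y≤ → ∈-++⁺ˡ (block⊆ I s≤y y≤)
  ; block-reversed  = λ s≤u u<v v≤ → ++⁺ʳ [ x ] (block-reversed I s≤u u<v v≤)
  ; pred-before-top = pred-before-top′
  }
  where
  bounded′ : ∀ {y} → y ∈ P ++ [ x ] → y ≤ s + k
  bounded′ y∈ with ∈-snoc⁻ P y∈
  ... | inj₁ y∈P  = bounded I y∈P
  ... | inj₂ refl = ≤-trans (≤-trans (n≤1+n x) (<⇒≤ 1+x<s)) (m≤m+n s k)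
  pred-before-top′ : ∀ {y} → suc y ≡ s → y ∈ P ++ [ x ] → (y ∷ s ∷ []) ⊆ P ++ [ x ]
  pred-before-top′ 1+y≡s y∈ with ∈-snoc⁻ P y∈
  ... | inj₁ y∈P  = ++⁺ʳ [ x ] (pred-before-top I 1+y≡s y∈P)
  ... | inj₂ refl = contradiction 1+y≡s (<⇒≢ 1+x<s)

output-emit : ∀ {P x s b c} → OutputInvariant P s b c → b < x → x < c → OutputInvariant (P ++ [ x ]) s x c
output-emit {P} {x} {s} {b} {c} I b<x x<c = record
  { output-bound = output-bound′
  ; emitted-seen = inj₂ (∈-snoc P x , x<c)
  ; carried-seen = map₂ ∈-++⁺ˡ (carried-seen I)
  ; carried<top  = carried<top I
  }
  where
  output-bound′ : ∀ {y} → y ∈ P ++ [ x ] → y < s → y ≤ c × (y ≡ c ⊎ y ≤ x)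
  output-bound′ y∈ y<s with ∈-snoc⁻ P y∈
  ... | inj₂ refl = <⇒≤ x<c , inj₂ ≤-refl
  ... | inj₁ y∈P with output-bound I y∈P y<s
  ...   | y≤c , inj₁ y≡c = y≤c , inj₁ y≡c
  ...   | y≤c , inj₂ y≤b = y≤c , inj₂ (≤-trans y≤b (<⇒≤ b<x))

output-carry : ∀ {P x s b c} → OutputInvariant P s b c → c < x → x < s → OutputInvariant (P ++ [ x ]) s c x
output-carry {P} {x} {s} {b} {c} I c<x x<s = record
  { output-bound = output-bound′
  ; emitted-seen = map₂ (λ c∈P → ∈-++⁺ˡ c∈P , c<x) (carried-seen I)
  ; carried-seen = inj₂ (∈-snoc P x)
  ; carried<top  = x<s
  }
  where
  output-bound′ : ∀ {y} → y ∈ P ++ [ x ] → y < s → y ≤ x × (y ≡ x ⊎ y ≤ c)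
  output-bound′ y∈ y<s with ∈-snoc⁻ P y∈
  ... | inj₂ refl = ≤-refl , inj₁ refl
  ... | inj₁ y∈P  = let y≤c = proj₁ (output-bound I y∈P y<s) in ≤-trans y≤c (<⇒≤ c<x) , inj₂ y≤c

block-exceeded : ∀ {P x s k} → StackInvariant P s k → x ∉ P → s ≤ x → s + k < x
block-exceeded I x∉P s≤x = ≰⇒> (λ x≤s+k → x∉P (block⊆ I s≤x x≤s+k))

stack-pop : ∀ {P x s k} → StackInvariant P s k → x ∉ P → s ≤ x → StackInvariant (P ++ [ x ]) x 0
stack-pop I x∉P s≤x = stack-new-max (λ y∈P → ≤-<-trans (bounded I y∈P) (block-exceeded I x∉P s≤x))

emitted-after-pop : ∀ {P s b c} k → StackInvariant P s k → OutputInvariant P s b c →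
                    blockEmitted c s k ≡ 0 ⊎ (blockEmitted c s k ∈ P × blockEmitted c s k < s + k)
emitted-after-pop {s = s} zero S O with carried-seen O
... | inj₁ c≡0 = inj₁ c≡0
... | inj₂ c∈P = inj₂ (c∈P , ≤-trans (carried<top O) (m≤m+n s 0))
emitted-after-pop {s = s} (suc k) S O =
  inj₂ (block⊆ S (m≤m+n s k) (+-monoʳ-≤ s (n≤1+n k)) , +-monoʳ-< s (n<1+n k))

output-pop : ∀ {P x s k b c} → StackInvariant P s k → OutputInvariant P s b c → x ∉ P → s ≤ x →
             OutputInvariant (P ++ [ x ]) x (blockEmitted c s k) (s + k)
output-pop {P} {x} {s} {k} {b} {c} S O x∉P s≤x = record
  { output-bound = output-bound′
  ; emitted-seen = map₂ (map₁ ∈-++⁺ˡ) (emitted-after-pop k S O)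
  ; carried-seen = inj₂ (∈-++⁺ˡ (block⊆ S (m≤m+n s k) ≤-refl))
  ; carried<top  = block-exceeded S x∉P s≤x
  }
  where
  output-bound′ : ∀ {y} → y ∈ P ++ [ x ] → y < x → y ≤ s + k × (y ≡ s + k ⊎ y ≤ blockEmitted c s k)
  output-bound′ {y} y∈ y<x with ∈-snoc⁻ P y∈
  ... | inj₂ refl = contradiction y<x (<-irrefl refl)
  ... | inj₁ y∈P with bounded S y∈P | y <? s
  ...   | y≤s+k | yes y<s =
    y≤s+k , inj₂ (≤-trans (proj₁ (output-bound O y∈P y<s)) (c≤blockEmitted k (<⇒≤ (carried<top O))))
  ...   | y≤s+k | no  y≮s with m≤n⇒m<n∨m≡n y≤s+k
  ...     | inj₁ y<s+k = y≤s+k , inj₂ (inner≤blockEmitted k (≮⇒≥ y≮s) y<s+k)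
  ...     | inj₂ y≡s+k = y≤s+k , inj₁ y≡s+k

-- The state after reading part of the input: PSB holds the stack (block top depth), and the pass on the
-- output so far has last emitted `emitted` and carries `carried`, where 0 means none (entries are positive).
record Config : Set where
  constructor config
  field
    top depth emitted carried : ℕ

record Invariant (P : List ℕ) (κ : Config) : Set where
  constructor _,_
  open Config κ
  field
    stack  : StackInvariant P top depth
    output : OutputInvariant P top emitted carried

invariant-start : ∀ {x} → 0 < x → Invariant [ x ] (config x 0 0 0)
invariant-start 0<x = stack-new-max {[]} (λ ()) , output-start 0<x

Passes : Config → List ℕ → Set
Passes (config s k b c) R = BubbleRun b c (psb-go (block s k) [] R)

-- Reading x breaks the pass only if x bypasses the stack and is emitted at once, below the last emission.
Guard : Config → ℕ → Set
Guard (config s k b c) x = suc x < s → x < c → b < x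

passes⇒guard : ∀ {κ x} R → Passes κ (x ∷ R) → Guard κ x
passes⇒guard {config s k b c} {x} R passes 1+x<s x<c =
  proj₁ (Equivalence.to (emit⇔ x<c) (subst (BubbleRun b c) (psb-bypass _ R 1+x<s) passes))

step : ∀ {P κ x} R → Invariant P κ → x ∉ P → 0 < x → Guard κ x →
       ∃[ κ′ ] Invariant (P ++ [ x ]) κ′ × (Passes κ (x ∷ R) ⇔ Passes κ′ R)
step {P} {config s k b c} {x} R (S , O) x∉P 0<x guard with <-cmp (suc x) s
... | tri≈ _ refl _ rewrite psb-push x (blockFrom (suc (suc x)) k) R =
  config x (suc k) b c , (stack-push S , output-push O x∉P 0<x) , ⇔-refl
... | tri> _ _ s<1+x rewrite psb-pop (blockFrom (suc s) k) R (s≤s⁻¹ s<1+x) =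
  config x 0 (blockEmitted c s k) (s + k) ,
  (stack-pop S x∉P (s≤s⁻¹ s<1+x) , output-pop S O x∉P (s≤s⁻¹ s<1+x)) ,
  BubbleRun-block k _ (carried<top O)
... | tri< 1+x<s _ _ with x <? c
...   | yes x<c rewrite psb-bypass (blockFrom (suc s) k) R 1+x<s =
  config s k x c , (stack-bypass S 1+x<s , output-emit O b<x x<c) ,
  ⇔-trans (emit⇔ x<c) (mk⇔ proj₂ (b<x ,_))
  where b<x = guard 1+x<s x<c
...   | no  x≮c rewrite psb-bypass (blockFrom (suc s) k) R 1+x<s =
  config s k c x , (stack-bypass S 1+x<s , output-carry O c<x (<-trans (n<1+n x) 1+x<s)) , carry⇔ c<x
  where
  c≢x : c ≢ x
  c≢x c≡x with carried-seen O
  ... | inj₁ c≡0 = contradiction (trans (sym c≡x) c≡0) (>⇒≢ 0<x)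
  ... | inj₂ c∈P = x∉P (subst (_∈ P) c≡x c∈P)
  c<x = ≤∧≢⇒< (≮⇒≥ x≮c) c≢x
-- The configurations around an entry x, with P read before and R after it, that force one of the patterns.
data Obstruction (P : List ℕ) (x : ℕ) (R : List ℕ) : Set where
  ascent : ∀ {u v w} → u ∈ P → (v ∷ w ∷ []) ⊆ P → x < u → u < v → v < w → Obstruction P x R
  gap    : ∀ {u v w e} → u ∈ P → v ∈ P → e ∈ P → w ∈ R → x < u → u < v → v < w → w < e → Obstruction P x R

ObstructionFree : List ℕ → Set
ObstructionFree π = ∀ {P x R} → P ++ x ∷ R ≡ π → ¬ Obstruction P x R

<-step⇒monotone : ∀ (f : ℕ → ℕ) → (∀ i → f i < f (suc i)) → f Preserves _<_ ⟶ _<_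
<-step⇒monotone f rises {i} {suc j} i<1+j with m≤n⇒m<n∨m≡n (s≤s⁻¹ i<1+j)
... | inj₁ i<j  = <-trans (<-step⇒monotone f rises i<j) (rises j)
... | inj₂ refl = rises i

ordIso-map : ∀ f → f Preserves _<_ ⟶ _<_ → ∀ p → OrdIso (map f p) p
ordIso-map f mono []      = []
ordIso-map f mono (i ∷ p) = pointwise p ∷ ordIso-map f mono p
  where
  reflects : ∀ a c → (f a < f c) ⇔ (a < c)
  reflects a c = mk⇔ to mono
    where
    to : f a < f c → a < c
    to fa<fc with <-cmp a c
    ... | tri< a<c _ _ = a<c
    ... | tri≈ _ refl _ = contradiction fa<fc (<-irrefl refl)
    ... | tri> _ _ c<a = contradiction (mono c<a) (<-asym fa<fc)
  pointwise : ∀ q → Pointwise (λ x′ y′ → ((f i < x′) ⇔ (i < y′)) × ((x′ < f i) ⇔ (y′ < i))) (map f q) q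
  pointwise []      = []
  pointwise (j ∷ q) = (reflects i j , reflects j i) ∷ pointwise q

-- Sends 1, …, 5 to a₁, …, a₅; the other values only make it strictly increasing on all of ℕ.
embed : ℕ → ℕ → ℕ → ℕ → ℕ → ℕ → ℕ
embed a₁ a₂ a₃ a₄ a₅ 0 = 0
embed a₁ a₂ a₃ a₄ a₅ 1 = a₁
embed a₁ a₂ a₃ a₄ a₅ 2 = a₂
embed a₁ a₂ a₃ a₄ a₅ 3 = a₃
embed a₁ a₂ a₃ a₄ a₅ 4 = a₄
embed a₁ a₂ a₃ a₄ a₅ (suc (suc (suc (suc (suc m))))) = m + a₅

embed-occurs : ∀ {π a₁ a₂ a₃ a₄ a₅} → 0 < a₁ → a₁ < a₂ → a₂ < a₃ → a₃ < a₄ → a₄ < a₅ →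
               ∀ p → map (embed a₁ a₂ a₃ a₄ a₅) p ⊆ π → Contains π p
embed-occurs {π} {a₁} {a₂} {a₃} {a₄} {a₅} 0<a₁ a₁<a₂ a₂<a₃ a₃<a₄ a₄<a₅ p sub =
  map f p , sub , ordIso-map f (<-step⇒monotone f rises) p
  where
  f = embed a₁ a₂ a₃ a₄ a₅
  rises : ∀ i → f i < f (suc i)
  rises 0 = 0<a₁
  rises 1 = a₁<a₂
  rises 2 = a₂<a₃
  rises 3 = a₃<a₄
  rises 4 = a₄<a₅
  rises (suc (suc (suc (suc (suc m))))) = n<1+n (m + a₅)

obstruction⇒contains : ∀ {P x R} → 0 < x → Obstruction P x R → ∃[ p ] (p ∈ patterns18 × Contains (P ++ x ∷ R) p)
obstruction⇒contains {R = R} 0<x (ascent {u} {v} {w} u∈P vw x<u u<v v<w)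
  with insert-ordered u∈P vw (<⇒≢ u<v) (<⇒≢ (<-trans u<v v<w))
... | inj₁ uvw        = _ , here refl ,
  embed-occurs 0<x x<u u<v v<w (n<1+n w) (2 ∷ 3 ∷ 4 ∷ 1 ∷ []) (++⁺ uvw (refl ∷ minimum R))
... | inj₂ (inj₁ vuw) = _ , there (there (here refl)) ,
  embed-occurs 0<x x<u u<v v<w (n<1+n w) (3 ∷ 2 ∷ 4 ∷ 1 ∷ []) (++⁺ vuw (refl ∷ minimum R))
... | inj₂ (inj₂ vwu) = _ , there (here refl) ,
  embed-occurs 0<x x<u u<v v<w (n<1+n w) (3 ∷ 4 ∷ 2 ∷ 1 ∷ []) (++⁺ vwu (refl ∷ minimum R))
obstruction⇒contains 0<x (gap {u} {v} {w} {e} u∈P v∈P e∈P w∈R x<u u<v v<w w<e)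
  with ∈⇒ordered v∈P e∈P (<⇒≢ (<-trans v<w w<e))
... | inj₁ ve = obstruction⇒contains 0<x (ascent u∈P ve x<u u<v (<-trans v<w w<e))
... | inj₂ ev with insert-ordered u∈P ev (<⇒≢ (<-trans u<v (<-trans v<w w<e))) (<⇒≢ u<v)
...   | inj₁ uev        = _ , there (there (there (here refl))) ,
  embed-occurs 0<x x<u u<v v<w w<e (2 ∷ 5 ∷ 3 ∷ 1 ∷ 4 ∷ []) (++⁺ uev (refl ∷ from∈ w∈R))
...   | inj₂ (inj₁ euv) = _ , there (there (there (there (here refl)))) ,
  embed-occurs 0<x x<u u<v v<w w<e (5 ∷ 2 ∷ 3 ∷ 1 ∷ 4 ∷ []) (++⁺ euv (refl ∷ from∈ w∈R))
...   | inj₂ (inj₂ evu) = _ , there (there (there (there (there (here refl))))) ,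
  embed-occurs 0<x x<u u<v v<w w<e (5 ∷ 3 ∷ 2 ∷ 1 ∷ 4 ∷ []) (++⁺ evu (refl ∷ from∈ w∈R))

iso-< : ∀ {x x′ y y′ : ℕ} → ((x < x′) ⇔ (y < y′)) × ((x′ < x) ⇔ (y′ < y)) → y < y′ → x < x′
iso-< = Equivalence.from ∘ proj₁

iso-> : ∀ {x x′ y y′ : ℕ} → ((x < x′) ⇔ (y < y′)) × ((x′ < x) ⇔ (y′ < y)) → y′ < y → x′ < x
iso-> = Equivalence.from ∘ proj₂

contains⇒obstruction : ∀ {π p} → p ∈ patterns18 → Contains π p →
                       ∃[ P ] ∃[ x ] ∃[ R ] (P ++ x ∷ R ≡ π × Obstruction P x R)
contains⇒obstruction (here refl) (a ∷ b ∷ c ∷ d ∷ [] , sub ,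
    (ab ∷ _ ∷ ad ∷ []) ∷ (bc ∷ _) ∷ _)
  with P , R , eq , abc , _ ← ⊆-split (a ∷ b ∷ c ∷ []) d [] sub =
  P , d , R , eq , ascent (Any-resp-⊆ abc (here refl)) (⊆-trans (a ∷ʳ refl ∷ refl ∷ []) abc)
                          (iso-> ad (n<1+n 1)) (iso-< ab (n<1+n 2)) (iso-< bc (n<1+n 3))
contains⇒obstruction (there (here refl)) (a ∷ b ∷ c ∷ d ∷ [] , sub ,
    (ab ∷ ac ∷ _) ∷ _ ∷ (cd ∷ []) ∷ _)
  with P , R , eq , abc , _ ← ⊆-split (a ∷ b ∷ c ∷ []) d [] sub =
  P , d , R , eq , ascent (Any-resp-⊆ abc (there (there (here refl)))) (⊆-trans (refl ∷ refl ∷ c ∷ʳ []) abc)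
                          (iso-> cd (n<1+n 1)) (iso-> ac (n<1+n 2)) (iso-< ab (n<1+n 3))
contains⇒obstruction (there (there (here refl))) (a ∷ b ∷ c ∷ d ∷ [] , sub ,
    (ab ∷ ac ∷ _) ∷ (_ ∷ bd ∷ []) ∷ _)
  with P , R , eq , abc , _ ← ⊆-split (a ∷ b ∷ c ∷ []) d [] sub =
  P , d , R , eq , ascent (Any-resp-⊆ abc (there (here refl))) (⊆-trans (refl ∷ b ∷ʳ refl ∷ []) abc)
                          (iso-> bd (n<1+n 1)) (iso-> ab (n<1+n 2)) (iso-< ac (n<1+n 3))
contains⇒obstruction (there (there (there (here refl)))) (a ∷ b ∷ c ∷ d ∷ e ∷ [] , sub ,
    (_ ∷ ac ∷ ad ∷ _) ∷ (_ ∷ _ ∷ be ∷ []) ∷ (_ ∷ ce ∷ []) ∷ _)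
  with P , R , eq , abc , e∈ ← ⊆-split (a ∷ b ∷ c ∷ []) d (e ∷ []) sub =
  P , d , R , eq , gap (Any-resp-⊆ abc (here refl)) (Any-resp-⊆ abc (there (there (here refl))))
                       (Any-resp-⊆ abc (there (here refl))) (Any-resp-⊆ e∈ (here refl))
                       (iso-> ad (n<1+n 1)) (iso-< ac (n<1+n 2)) (iso-< ce (n<1+n 3)) (iso-> be (n<1+n 4))
contains⇒obstruction (there (there (there (there (here refl))))) (a ∷ b ∷ c ∷ d ∷ e ∷ [] , sub ,
    (_ ∷ _ ∷ _ ∷ ae ∷ []) ∷ (bc ∷ bd ∷ _) ∷ (_ ∷ ce ∷ []) ∷ _)
  with P , R , eq , abc , e∈ ← ⊆-split (a ∷ b ∷ c ∷ []) d (e ∷ []) sub =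
  P , d , R , eq , gap (Any-resp-⊆ abc (there (here refl))) (Any-resp-⊆ abc (there (there (here refl))))
                       (Any-resp-⊆ abc (here refl)) (Any-resp-⊆ e∈ (here refl))
                       (iso-> bd (n<1+n 1)) (iso-< bc (n<1+n 2)) (iso-< ce (n<1+n 3)) (iso-> ae (n<1+n 4))
contains⇒obstruction (there (there (there (there (there (here refl)))))) (a ∷ b ∷ c ∷ d ∷ e ∷ [] , sub ,
    (_ ∷ _ ∷ _ ∷ ae ∷ []) ∷ (bc ∷ _ ∷ be ∷ []) ∷ (cd ∷ _) ∷ _)
  with P , R , eq , abc , e∈ ← ⊆-split (a ∷ b ∷ c ∷ []) d (e ∷ []) sub =
  P , d , R , eq , gap (Any-resp-⊆ abc (there (there (here refl)))) (Any-resp-⊆ abc (there (here refl)))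
                       (Any-resp-⊆ abc (here refl)) (Any-resp-⊆ e∈ (here refl))
                       (iso-> cd (n<1+n 1)) (iso-> bc (n<1+n 2)) (iso-< be (n<1+n 3)) (iso-> ae (n<1+n 4))
contains⇒obstruction (there (there (there (there (there (there ())))))) _

avoids⇔obstruction-free : ∀ {π} → (∀ {x} → x ∈ π → 0 < x) → Avoids π patterns18 ⇔ ObstructionFree π
avoids⇔obstruction-free {π} positive = mk⇔ to from
  where
  to : Avoids π patterns18 → ObstructionFree π
  to avoids {P} refl obstruction
    with p , p∈ , occurrence ← obstruction⇒contains (positive (∈-++⁺ʳ P (here refl))) obstruction =
    avoids p p∈ occurrence
  from : ObstructionFree π → Avoids π patterns18
  from free p p∈ occurrence with P , x , R , eq , obstruction ← contains⇒obstruction p∈ occurrence =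
    free eq obstruction

obstruction-blocks : ∀ {P z R κ} → Invariant P κ → Unique (P ++ z ∷ R) → Obstruction P z R → ¬ Passes κ (z ∷ R)
obstruction-blocks {P} {z} {R} {κ@(config s k b c)} (S , O) unique obstruction passes = blocked obstruction
  where
  -- u and v have been output, so z bypasses the stack and is emitted at once, yet b ≥ u > z.
  emitted-pair : ∀ {u v} → u ∈ P → v ∈ P → z < u → u < v → v < s → ⊥
  emitted-pair u∈P v∈P z<u u<v v<s with output-bound O v∈P v<s | output-bound O u∈P (<-trans u<v v<s)
  ... | v≤c , _ | _ , inj₁ refl = contradiction u<v (≤⇒≯ v≤c)
  ... | v≤c , _ | _ , inj₂ u≤b  =
    <-asym (passes⇒guard {κ} R passes (≤-<-trans z<u (<-trans u<v v<s)) (<-≤-trans (<-trans z<u u<v) v≤c))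
           (<-≤-trans z<u u≤b)
  blocked : Obstruction P z R → ⊥
  blocked (ascent {v = v} u∈P vw z<u u<v v<w) with v <? s
  ... | yes v<s = emitted-pair u∈P (Any-resp-⊆ vw (here refl)) z<u u<v v<s
  ... | no  v≮s = Unique⇒¬both-orders (Unique-++⁻ˡ P unique) (<⇒≢ v<w) vw
                    (block-reversed S (≮⇒≥ v≮s) v<w (bounded S (Any-resp-⊆ vw (there (here refl)))))
  blocked (gap {v = v} u∈P v∈P e∈P w∈R z<u u<v v<w w<e) with v <? s
  ... | yes v<s = emitted-pair u∈P v∈P z<u u<v v<s
  ... | no  v≮s = Unique-++⇒disjoint P unique
                    (block⊆ S (≤-trans (≮⇒≥ v≮s) (<⇒≤ v<w)) (≤-trans (<⇒≤ w<e) (bounded S e∈P))) (there w∈R)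

module _ {n π} (π↭id : IsPerm n π) where

  private
    unique : Unique π
    unique = IsPerm⇒Unique π↭id

    positive : ∀ {x} → x ∈ π → 0 < x
    positive = IsPerm⇒positive π↭id

    next∈ : ∀ {P x R} → P ++ x ∷ R ≡ π → x ∈ π
    next∈ {P} refl = ∈-++⁺ʳ P (here refl)

    fresh : ∀ {P x R} → P ++ x ∷ R ≡ π → x ∉ P
    fresh {P} refl x∈P = Unique-++⇒disjoint P unique x∈P (here refl)

  reach : ∀ Q {P R κ} → P ++ Q ++ R ≡ π → Invariant P κ → Passes κ (Q ++ R) →
          ∃[ κ′ ] Invariant (P ++ Q) κ′ × Passes κ′ R
  reach []      {P} _ I passes = _ , subst (λ L → Invariant L _) (sym (++-identityʳ P)) I , passes
  reach (q ∷ Q) {P} {R} {κ} eq I passes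
    with κ′ , I′ , equiv ← step (Q ++ R) I (fresh eq) (positive (next∈ eq)) (passes⇒guard {κ} (Q ++ R) passes)
    with κ″ , I″ , passes″ ← reach Q (trans (++-assoc P [ q ] (Q ++ R)) eq) I′ (Equivalence.to equiv passes) =
    κ″ , subst (λ L → Invariant L κ″) (++-assoc P [ q ] Q) I″ , passes″

  passes⇒obstruction-free : BubbleRun 0 0 (psb π) → ObstructionFree π
  passes⇒obstruction-free passes {[]}    eq (ascent () _ _ _ _)
  passes⇒obstruction-free passes {[]}    eq (gap () _ _ _ _ _ _ _)
  passes⇒obstruction-free passes {p ∷ P} {x} {R} refl obstruction
    with κ , I , passes′ ← reach P refl (invariant-start (positive (here refl))) passes =
    obstruction-blocks I unique obstruction passes′

  obstruction-at-bypass : ∀ {P x R s k b c} → P ++ x ∷ R ≡ π → Invariant P (config s k b c) →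
                          suc x < s → x < b → b ∈ P → b < c → Obstruction P x R
  obstruction-at-bypass {P} {x} {R} {suc w} {k} {b} {c} eq (S , O) 1+x<s x<b b∈P b<c =
    locate (∈-++⁻ P (subst (w ∈_) (sym eq) w∈π))
    where
    c∈P : c ∈ P
    c∈P with carried-seen O
    ... | inj₁ refl = contradiction b<c n≮0
    ... | inj₂ c∈P  = c∈P
    c≤w : c ≤ w
    c≤w = s≤s⁻¹ (carried<top O)
    x<w : x < w
    x<w = <-≤-trans (<-trans x<b b<c) c≤w
    s∈P : suc w ∈ P
    s∈P = block⊆ S ≤-refl (m≤m+n (suc w) k)
    w∈π : w ∈ π
    w∈π = IsPerm⇒pred∈ π↭id (subst (suc w ∈_) eq (∈-++⁺ˡ s∈P)) (≤-<-trans z≤n x<w)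
    locate : w ∈ P ⊎ w ∈ x ∷ R → Obstruction P x R
    locate (inj₁ w∈P)         = ascent b∈P (pred-before-top S refl w∈P) x<b (<-≤-trans b<c c≤w) (n<1+n w)
    locate (inj₂ (here w≡x))  = contradiction w≡x (>⇒≢ x<w)
    locate (inj₂ (there w∈R)) = gap b∈P c∈P s∈P w∈R x<b b<c c<w (n<1+n w)
      where
      c<w = ≤∧≢⇒< c≤w (λ { refl → Unique-++⇒disjoint P (subst Unique (sym eq) unique) c∈P (there w∈R) })

  guard-from-free : ∀ {P x R κ} → ObstructionFree π → P ++ x ∷ R ≡ π → Invariant P κ → Guard κ x
  guard-from-free {P} {x} {κ = config s k b c} free eq I 1+x<s x<c with b <? x
  ... | yes b<x = b<x
  ... | no  b≮x with emitted-seen (Invariant.output I)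
  ...   | inj₁ refl = positive (next∈ eq)
  ...   | inj₂ (b∈P , b<c) = contradiction (obstruction-at-bypass eq I 1+x<s x<b b∈P b<c) (free eq)
    where x<b = ≤∧≢⇒< (≮⇒≥ b≮x) (λ { refl → fresh eq b∈P })

  passes-from : ObstructionFree π → ∀ R {P κ} → P ++ R ≡ π → Invariant P κ → Passes κ R
  passes-from free []      {κ = config s k b c} _ (_ , O) =
    subst (BubbleRun b c) (++-identityʳ (block s k))
      (Equivalence.from (BubbleRun-block k [] (carried<top O)) [])
  passes-from free (q ∷ R) {P} eq I
    with κ′ , I′ , equiv ← step R I (fresh eq) (positive (next∈ eq)) (guard-from-free free eq I) =
    Equivalence.from equiv (passes-from free R (trans (++-assoc P [ q ] R) eq) I′)

  passes⇔obstruction-free : BubbleRun 0 0 (psb π) ⇔ ObstructionFree π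
  passes⇔obstruction-free = mk⇔ passes⇒obstruction-free (λ free → from free π refl)
    where
    from : ObstructionFree π → ∀ L → L ≡ π → BubbleRun 0 0 (psb L)
    from free []      _  = []
    from free (p ∷ L) eq = passes-from free L eq (invariant-start (positive (next∈ {[]} eq)))

mainTheorem18 : (n : ℕ) (π : List ℕ) → IsPerm n π →
                (bub (psb π) ≡ idPerm n) ⇔ Avoids π patterns18
mainTheorem18 n π π↭id = begin
  bub (psb π) ≡ idPerm n     ≈⟨ bub-sorts⇔ (↭-trans (psb-↭ π) π↭id) ⟩
  BubbleRun 0 0 (psb π)     ≈⟨ passes⇔obstruction-free π↭id ⟩
  ObstructionFree π         ≈⟨ avoids⇔obstruction-free (IsPerm⇒positive π↭id) ⟨
  Avoids π patterns18       ∎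
  where open SetoidReasoning (⇔-setoid 0ℓ)
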